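{- Let $\mathcal{S}$ be a minimal presentation of the transversal matroid $\mathcal{B}(\mathcal{S})$ on $[n]$. Let $\mathcal{T},\mathcal{T}'\subseteq\mathcal{S}$ be exact subsystems and suppose there is a set $S\in\mathcal{T}\cap\mathcal{T}'$ with $|S|=\max_{T\in\mathcal{T}\cup\mathcal{T}'}|T|$. Then $\mathcal{T}\cup\mathcal{T}'$ is an exact subsystem.
   Context: A set system $\mathcal{S}=\{S_1,\dots,S_k\}$ is an unordered family of $k$ subsets of $[n]$ (repetitions allowed); the transversal matroid $\mathcal{B}(\mathcal{S})$ is the set of $B\in\binom{[n]}{k}$ such that the bipartite graph with edges $S_i$—$j$ ($j\in S_i$) has a matching saturating $B$. $\mathcal{S}$ is a minimal presentation iff for every nonempty $\mathcal{T}\subseteq\mathcal{S}$, $|\bigcup_{T\in\mathcal{T}}T|\ge\max_{T\in\mathcal{T}}|T|+|\mathcal{T}|-1$ (equivalently, $\mathcal{S}$ is minimal, under the order "sets can be indexed so that $S_i\subseteq S'_i$", among $k$-set presentations of its transversal matroid). A nonempty subfamily $\mathcal{T}\subseteq\mathcal{S}$ is exact if $|\bigcup_{T\in\mathcal{T}}T|=|\mathcal{T}|+\max_{T\in\mathcal{T}}|T|-1$. -}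

module Defs where

open import Data.Nat using (ℕ; _+_; _∸_; _⊔_; _≥_)
open import Data.Bool using (Bool; true; false)
open import Data.Vec using (Vec; []; _∷_)
open import Data.Fin using (Fin; zero; suc)
open import Data.Fin.Subset using (Subset; ⊥; _∪_; ∣_∣; Nonempty)
open import Data.Product using (_×_)
open import Relation.Binary.PropositionalEquality using (_≡_)

-- A set system S = {S_1,...,S_k} of subsets of [n], as an indexed family
-- (so repetitions are allowed).  A subsystem T ⊆ S is a set of indices.
SetSystem : ℕ → ℕ → Set
SetSystem n k = Fin k → Subset n

unionOver : ∀ {n k} → SetSystem n k → Subset k → Subset n
unionOver {k = ℕ.zero} S [] = ⊥
unionOver {k = ℕ.suc k} S (true ∷ I) = S zero ∪ unionOver (λ i → S (suc i)) I
unionOver {k = ℕ.suc k} S (false ∷ I) = unionOver (λ i → S (suc i)) I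

-- max_{i ∈ I} |S_i|   (0 for empty I)
maxOver : ∀ {n k} → SetSystem n k → Subset k → ℕ
maxOver {k = ℕ.zero} S [] = 0
maxOver {k = ℕ.suc k} S (true ∷ I) = ∣ S zero ∣ ⊔ maxOver (λ i → S (suc i)) I
maxOver {k = ℕ.suc k} S (false ∷ I) = maxOver (λ i → S (suc i)) I

MinimalPresentation : ∀ {n k} → SetSystem n k → Set
MinimalPresentation {k = k} S =
  (I : Subset k) → Nonempty I → ∣ unionOver S I ∣ ≥ maxOver S I + ∣ I ∣ ∸ 1

Exact : ∀ {n k} → SetSystem n k → Subset k → Set
Exact S I = Nonempty I × (∣ unionOver S I ∣ ≡ ∣ I ∣ + maxOver S I ∸ 1)

module Submission where

-- Write ⋃I for the union of the sets indexed by I and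
-- M = max_{T ∪ T′} |S_j| = |S_i|.  Since S_i lies in T, T′ and T ∩ T′, each of
-- these families also has maximum M.  The union map I ↦ |⋃I| is submodular:
--     |⋃(T ∪ T′)| + |⋃(T ∩ T′)| ≤ |⋃T| + |⋃T′|,
-- because ⋃(T ∪ T′) ⊆ ⋃T ∪ ⋃T′, ⋃(T ∩ T′) ⊆ ⋃T ∩ ⋃T′, and |A ∪ B| + |A ∩ B| =
-- |A| + |B|.  Exactness of T, T′ turns the right side into
--     (|T| + M - 1) + (|T′| + M - 1) = (|T ∪ T′| + M - 1) + (|T ∩ T′| + M - 1),
-- while minimality applied to the nonempty family T ∩ T′ bounds |⋃(T ∩ T′)|
-- below by |T ∩ T′| + M - 1.  Cancelling gives |⋃(T ∪ T′)| ≤ |T ∪ T′| + M - 1,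
-- and minimality applied to T ∪ T′ gives the reverse inequality.

open import Defs
open import Data.Nat using (ℕ)
open import Data.Fin using (Fin)
open import Data.Fin.Subset using (Subset; _∈_; _∪_; ∣_∣)
open import Relation.Binary.PropositionalEquality using (_≡_)

open import Data.Nat using (zero; suc; _+_; _∸_; _≤_; z≤n; s≤s)
open import Data.Nat.Properties
  using (≤-trans; ≤-antisym; m≤m⊔n; m≤n⊔m; ⊔-lub; +-comm; +-suc;
         suc-injective; +-mono-≤; +-monoʳ-≤; +-cancelʳ-≤; +-commutativeSemigroup;
         module ≤-Reasoning)
open import Data.Fin using (zero; suc)
open import Data.Fin.Subset using (_⊆_; _∩_; Nonempty)
open import Data.Fin.Subset.Properties
  using (x∈p∪q⁻; x∈p∪q⁺; x∈p∩q⁺; x∈p∩q⁻; p⊆p∪q; q⊆p∪q; p∩q⊆p; p⊆q⇒∣p∣≤∣q∣; ∉⊥)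
open import Data.Vec using ([]; _∷_; here; there)
open import Data.Product using (_×_; _,_; ∃)
open import Data.Sum using (inj₁; inj₂)
open import Data.Bool using (true; false)
open import Relation.Binary.PropositionalEquality
  using (refl; sym; trans; cong; cong₂; subst; module ≡-Reasoning)
open import Relation.Nullary using (contradiction)
open import Algebra.Properties.CommutativeSemigroup +-commutativeSemigroup
  using (interchange)

tail : ∀ {n k} → SetSystem n (suc k) → SetSystem n k
tail S j = S (suc j)

∈unionOver⁻ : ∀ {n k} (S : SetSystem n k) (I : Subset k) {x : Fin n} →
              x ∈ unionOver S I → ∃ λ j → j ∈ I × x ∈ S j
∈unionOver⁻ {k = zero} S [] x∈ = contradiction x∈ ∉⊥
∈unionOver⁻ {k = suc k} S (true ∷ I) x∈ with x∈p∪q⁻ (S zero) (unionOver (tail S) I) x∈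
... | inj₁ x∈S₀ = zero , here , x∈S₀
... | inj₂ x∈rest with ∈unionOver⁻ (tail S) I x∈rest
...   | j , j∈I , x∈Sj = suc j , there j∈I , x∈Sj
∈unionOver⁻ {k = suc k} S (false ∷ I) x∈ with ∈unionOver⁻ (tail S) I x∈
... | j , j∈I , x∈Sj = suc j , there j∈I , x∈Sj

∈unionOver⁺ : ∀ {n k} (S : SetSystem n k) (I : Subset k) {x : Fin n} (j : Fin k) →
              j ∈ I → x ∈ S j → x ∈ unionOver S I
∈unionOver⁺ S (true ∷ I) zero here x∈ = x∈p∪q⁺ (inj₁ x∈)
∈unionOver⁺ S (true ∷ I) (suc j) (there j∈I) x∈ =
  x∈p∪q⁺ (inj₂ (∈unionOver⁺ (tail S) I j j∈I x∈))
∈unionOver⁺ S (false ∷ I) (suc j) (there j∈I) x∈ = ∈unionOver⁺ (tail S) I j j∈I x∈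

unionOver-∪ : ∀ {n k} (S : SetSystem n k) (I J : Subset k) →
              unionOver S (I ∪ J) ⊆ unionOver S I ∪ unionOver S J
unionOver-∪ S I J x∈ with ∈unionOver⁻ S (I ∪ J) x∈
... | j , j∈I∪J , x∈Sj with x∈p∪q⁻ I J j∈I∪J
...   | inj₁ j∈I = x∈p∪q⁺ (inj₁ (∈unionOver⁺ S I j j∈I x∈Sj))
...   | inj₂ j∈J = x∈p∪q⁺ (inj₂ (∈unionOver⁺ S J j j∈J x∈Sj))

unionOver-∩ : ∀ {n k} (S : SetSystem n k) (I J : Subset k) →
              unionOver S (I ∩ J) ⊆ unionOver S I ∩ unionOver S J
unionOver-∩ S I J x∈ with ∈unionOver⁻ S (I ∩ J) x∈
... | j , j∈I∩J , x∈Sj with x∈p∩q⁻ I J j∈I∩J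
...   | j∈I , j∈J = x∈p∩q⁺ (∈unionOver⁺ S I j j∈I x∈Sj , ∈unionOver⁺ S J j j∈J x∈Sj)

maxOver-upper : ∀ {n k} (S : SetSystem n k) (I : Subset k) (j : Fin k) →
                j ∈ I → ∣ S j ∣ ≤ maxOver S I
maxOver-upper S (true ∷ I) zero here = m≤m⊔n _ _
maxOver-upper S (true ∷ I) (suc j) (there j∈I) =
  ≤-trans (maxOver-upper (tail S) I j j∈I) (m≤n⊔m _ _)
maxOver-upper S (false ∷ I) (suc j) (there j∈I) = maxOver-upper (tail S) I j j∈I

maxOver-least : ∀ {n k} (S : SetSystem n k) (I : Subset k) (b : ℕ) →
                (∀ j → j ∈ I → ∣ S j ∣ ≤ b) → maxOver S I ≤ b
maxOver-least {k = zero} S [] b bound = z≤n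
maxOver-least {k = suc k} S (true ∷ I) b bound =
  ⊔-lub (bound zero here) (maxOver-least (tail S) I b (λ j j∈I → bound (suc j) (there j∈I)))
maxOver-least {k = suc k} S (false ∷ I) b bound =
  maxOver-least (tail S) I b (λ j j∈I → bound (suc j) (there j∈I))

maxOver-attained : ∀ {n k} (S : SetSystem n k) {I J : Subset k} {i : Fin k} →
                   J ⊆ I → i ∈ J → ∣ S i ∣ ≡ maxOver S I → maxOver S J ≡ maxOver S I
maxOver-attained S {I} {J} {i} J⊆I i∈J Si-max = ≤-antisym
  (maxOver-least S J (maxOver S I) (λ j j∈J → maxOver-upper S I j (J⊆I j∈J)))
  (subst (_≤ maxOver S J) Si-max (maxOver-upper S J i i∈J))

∣p∪q∣+∣p∩q∣ : ∀ {n} (p q : Subset n) → ∣ p ∪ q ∣ + ∣ p ∩ q ∣ ≡ ∣ p ∣ + ∣ q ∣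
∣p∪q∣+∣p∩q∣ [] [] = refl
∣p∪q∣+∣p∩q∣ (true ∷ p) (true ∷ q) = cong suc (begin
  ∣ p ∪ q ∣ + suc ∣ p ∩ q ∣ ≡⟨ +-suc _ _ ⟩
  suc (∣ p ∪ q ∣ + ∣ p ∩ q ∣) ≡⟨ cong suc (∣p∪q∣+∣p∩q∣ p q) ⟩
  suc (∣ p ∣ + ∣ q ∣) ≡⟨ +-suc _ _ ⟨
  ∣ p ∣ + suc ∣ q ∣ ∎)
  where open ≡-Reasoning
∣p∪q∣+∣p∩q∣ (true ∷ p) (false ∷ q) = cong suc (∣p∪q∣+∣p∩q∣ p q)
∣p∪q∣+∣p∩q∣ (false ∷ p) (true ∷ q) = trans (cong suc (∣p∪q∣+∣p∩q∣ p q)) (sym (+-suc _ _))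
∣p∪q∣+∣p∩q∣ (false ∷ p) (false ∷ q) = ∣p∪q∣+∣p∩q∣ p q

nonempty⇒∣p∣≥1 : ∀ {n} (p : Subset n) → Nonempty p → 1 ≤ ∣ p ∣
nonempty⇒∣p∣≥1 (true ∷ p) _ = s≤s z≤n
nonempty⇒∣p∣≥1 (false ∷ p) (suc x , there x∈p) = nonempty⇒∣p∣≥1 p (x , x∈p)

unionOver-submodular : ∀ {n k} (S : SetSystem n k) (I J : Subset k) →
  ∣ unionOver S (I ∪ J) ∣ + ∣ unionOver S (I ∩ J) ∣ ≤ ∣ unionOver S I ∣ + ∣ unionOver S J ∣
unionOver-submodular S I J = begin
  ∣ unionOver S (I ∪ J) ∣ + ∣ unionOver S (I ∩ J) ∣
    ≤⟨ +-mono-≤ (p⊆q⇒∣p∣≤∣q∣ (unionOver-∪ S I J)) (p⊆q⇒∣p∣≤∣q∣ (unionOver-∩ S I J)) ⟩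
  ∣ unionOver S I ∪ unionOver S J ∣ + ∣ unionOver S I ∩ unionOver S J ∣
    ≡⟨ ∣p∪q∣+∣p∩q∣ (unionOver S I) (unionOver S J) ⟩
  ∣ unionOver S I ∣ + ∣ unionOver S J ∣ ∎
  where open ≤-Reasoning

shifted-sum : ∀ {a b c d} m → 1 ≤ a → 1 ≤ b → 1 ≤ c → 1 ≤ d → a + b ≡ c + d →
              (a + m ∸ 1) + (b + m ∸ 1) ≡ (c + m ∸ 1) + (d + m ∸ 1)
shifted-sum {suc a} {suc b} {suc c} {suc d} m (s≤s _) (s≤s _) (s≤s _) (s≤s _) sum≡ = begin
  (a + m) + (b + m) ≡⟨ interchange a m b m ⟩
  (a + b) + (m + m) ≡⟨ cong (_+ (m + m)) predecessors-sum ⟩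
  (c + d) + (m + m) ≡⟨ interchange c d m m ⟩
  (c + m) + (d + m) ∎
  where
  open ≡-Reasoning
  predecessors-sum : a + b ≡ c + d
  predecessors-sum = suc-injective (begin
    suc (a + b) ≡⟨ +-suc a b ⟨
    a + suc b   ≡⟨ suc-injective sum≡ ⟩
    c + suc d   ≡⟨ +-suc c d ⟩
    suc (c + d) ∎)

-- Minimality, written in the same form as exactness: |I| + max_I - 1 ≤ |⋃I|.
minimal-lower : ∀ {n k} (S : SetSystem n k) → MinimalPresentation S →
                {I : Subset k} → Nonempty I → ∣ I ∣ + maxOver S I ∸ 1 ≤ ∣ unionOver S I ∣
minimal-lower S minimal {I} ne =
  subst (λ s → s ∸ 1 ≤ ∣ unionOver S I ∣) (+-comm (maxOver S I) ∣ I ∣) (minimal I ne)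

lemma6p9 : ∀ {n k} (S : SetSystem n k) → MinimalPresentation S →
    (T T′ : Subset k) → Exact S T → Exact S T′ →
    (i : Fin k) → i ∈ T → i ∈ T′ → ∣ S i ∣ ≡ maxOver S (T ∪ T′) →
    Exact S (T ∪ T′)
lemma6p9 S minimal T T′ (neT , exactT) (neT′ , exactT′) i i∈T i∈T′ Si-max =
  neU , ≤-antisym (+-cancelʳ-≤ (∣ T ∩ T′ ∣ + M ∸ 1) _ _ key) (minimal-lower S minimal neU)
  where
  open ≤-Reasoning
  M = maxOver S (T ∪ T′)
  neU : Nonempty (T ∪ T′)
  neU = i , x∈p∪q⁺ (inj₁ i∈T)
  i∈T∩T′ : i ∈ T ∩ T′
  i∈T∩T′ = x∈p∩q⁺ (i∈T , i∈T′)
  neI : Nonempty (T ∩ T′)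
  neI = i , i∈T∩T′
  -- the size an exact family with maximum M would have
  shifted : Subset _ → ℕ
  shifted I = ∣ I ∣ + M ∸ 1
  key : ∣ unionOver S (T ∪ T′) ∣ + shifted (T ∩ T′) ≤ shifted (T ∪ T′) + shifted (T ∩ T′)
  key = begin
    ∣ unionOver S (T ∪ T′) ∣ + shifted (T ∩ T′)
      ≡⟨ cong (λ m → ∣ unionOver S (T ∪ T′) ∣ + (∣ T ∩ T′ ∣ + m ∸ 1))
              (maxOver-attained S (λ x∈ → p⊆p∪q T′ (p∩q⊆p T T′ x∈)) i∈T∩T′ Si-max) ⟨
    ∣ unionOver S (T ∪ T′) ∣ + (∣ T ∩ T′ ∣ + maxOver S (T ∩ T′) ∸ 1)
      ≤⟨ +-monoʳ-≤ _ (minimal-lower S minimal neI) ⟩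
    ∣ unionOver S (T ∪ T′) ∣ + ∣ unionOver S (T ∩ T′) ∣
      ≤⟨ unionOver-submodular S T T′ ⟩
    ∣ unionOver S T ∣ + ∣ unionOver S T′ ∣
      ≡⟨ cong₂ _+_ exactT exactT′ ⟩
    (∣ T ∣ + maxOver S T ∸ 1) + (∣ T′ ∣ + maxOver S T′ ∸ 1)
      ≡⟨ cong₂ (λ m m′ → (∣ T ∣ + m ∸ 1) + (∣ T′ ∣ + m′ ∸ 1))
               (maxOver-attained S (p⊆p∪q T′) i∈T Si-max)
               (maxOver-attained S (q⊆p∪q T T′) i∈T′ Si-max) ⟩
    shifted T + shifted T′
      ≡⟨ shifted-sum M (nonempty⇒∣p∣≥1 T neT) (nonempty⇒∣p∣≥1 T′ neT′)
           (nonempty⇒∣p∣≥1 _ neU) (nonempty⇒∣p∣≥1 _ neI) (sym (∣p∪q∣+∣p∩q∣ T T′)) ⟩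
    shifted (T ∪ T′) + shifted (T ∩ T′) ∎
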